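{- Let $G$ be a graph, let $D$ be a minimum dominating set of $G$ and $\gamma=|D|$. Let $\nabla_1$ be an integer with $\nabla_1\ge\nabla_1(G)$ and let $\nabla$ be an integer with $\nabla_1^B(G)<\nabla\le\nabla_1+1$. Define $$\hat D=\{v\in V(G) : \text{for all } A\subseteq D\setminus\{v\} \text{ with } N(v)\subseteq N[A] \text{ we have } |A|>2\nabla-1\},$$ $$D_1=\{v\in V(G) : \text{for all } A\subseteq V(G)\setminus\{v\} \text{ with } N(v)\subseteq N[A] \text{ we have } |A|>2\nabla-1\}.$$ Then $D_1\subseteq\hat D$ and hence $|D_1\setminus D|\le\rho(G)\cdot\gamma$.
   Context: Graphs are finite, undirected and simple. $N(v)$ is the open neighborhood of $v$, $N[v]=N(v)\cup\{v\}$, and $N[A]=\bigcup_{v\in A}N[v]$. A dominating set is a set $D$ with $N[D]=V(G)$. A graph $H$ is a $1$-shallow minor of $G$ if there are pairwise vertex-disjoint connected subgraphs $G_v\subseteq G$ ($v\in V(H)$), each of radius at most $1$, such that whenever $\{u,v\}\in E(H)$ there is an edge of $G$ between $V(G_u)$ and $V(G_v)$. $\nabla_1(G)$ is the maximum of $|E(H)|/|V(H)|$ over all $1$-shallow minors $H$ of $G$, and $\nabla_1^B(G)$ the same maximum over bipartite $1$-shallow minors. The Hall ratio is $\rho(G)=\max\{|V(H)|/\alpha(H) : H\subseteq G\}$, where $\alpha(H)$ is the independence number of $H$. -}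

module Defs where

open import Data.Nat using (ℕ; zero; suc; _+_; _*_; _∸_; _≤_; _<_)
open import Data.Nat.Properties using (_<?_)
open import Data.Bool using (Bool; true; false)
open import Data.Bool.Properties using () renaming (_≟_ to _≟ᵇ_)
open import Data.Fin using (Fin; toℕ)
open import Data.Fin.Subset using (Subset; _∈_; _∉_; _⊆_; ∣_∣)
open import Data.List using (List; length; filter; concatMap; map; allFin)
open import Data.Product using (Σ; ∃; ∃-syntax; _×_; _,_; proj₁; proj₂)
open import Data.Sum using (_⊎_)
open import Relation.Binary.PropositionalEquality using (_≡_; _≢_)
open import Relation.Nullary.Decidable using (_×-dec_)

record Graph (n : ℕ) : Set where
  field
    adj    : Fin n → Fin n → Bool
    sym    : ∀ u v → adj u v ≡ adj v u
    irrefl : ∀ v → adj v v ≡ false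
open Graph public

allPairs : (n : ℕ) → List (Fin n × Fin n)
allPairs n = concatMap (λ u → map (λ v → (u , v)) (allFin n)) (allFin n)

numEdges : ∀ {n} → Graph n → ℕ
numEdges {n} G =
  length (filter (λ p → (toℕ (proj₁ p) <? toℕ (proj₂ p)) ×-dec (adj G (proj₁ p) (proj₂ p) ≟ᵇ true))
                 (allPairs n))

InN : ∀ {n} → Graph n → Fin n → Fin n → Set
InN G v u = adj G v u ≡ true

InNSet : ∀ {n} → Graph n → Subset n → Fin n → Set
InNSet G A u = u ∈ A ⊎ ∃[ a ] (a ∈ A × adj G a u ≡ true)

NbhdCovered : ∀ {n} → Graph n → Fin n → Subset n → Set
NbhdCovered G v A = ∀ u → InN G v u → InNSet G A u

IsDominating : ∀ {n} → Graph n → Subset n → Set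
IsDominating G D = ∀ u → InNSet G D u

IsMinDominating : ∀ {n} → Graph n → Subset n → Set
IsMinDominating {n} G D = IsDominating G D × (∀ (D' : Subset n) → IsDominating G D' → ∣ D ∣ ≤ ∣ D' ∣)

-- 1-shallow minors: branch sets are pairwise disjoint vertex sets each spanning
-- a connected subgraph of radius ≤ 1 (i.e. there is a centre adjacent to all
-- other vertices of the branch set); every edge of H is realised by an edge of G
-- between the corresponding branch sets.
record ShallowMinor1 {m n : ℕ} (H : Graph m) (G : Graph n) : Set where
  field
    branch   : Fin m → Subset n
    centre   : Fin m → Fin n
    centre∈  : ∀ i → centre i ∈ branch i
    star     : ∀ i v → v ∈ branch i → v ≡ centre i ⊎ adj G (centre i) v ≡ true
    disjoint : ∀ i j v → v ∈ branch i → v ∈ branch j → i ≡ j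
    realise  : ∀ i j → adj H i j ≡ true →
               ∃[ u ] ∃[ v ] (u ∈ branch i × v ∈ branch j × adj G u v ≡ true)

IsBipartite : ∀ {m} → Graph m → Set
IsBipartite {m} H = Σ (Fin m → Bool) λ c → ∀ i j → adj H i j ≡ true → c i ≢ c j

-- ∇₁(G) ≤ k   (k ∈ ℕ):  |E(H)| / |V(H)| ≤ k for every 1-shallow minor H.
Nabla1≤ : ∀ {n} → Graph n → ℕ → Set
Nabla1≤ G k = ∀ (m : ℕ) (H : Graph m) → ShallowMinor1 H G → numEdges H ≤ k * m

-- ∇₁ᴮ(G) < k:  |E(H)| / |V(H)| < k for every (non-empty) bipartite 1-shallow minor H.
Nabla1B< : ∀ {n} → Graph n → ℕ → Set
Nabla1B< G k = ∀ (m : ℕ) (H : Graph m) → 1 ≤ m → IsBipartite H → ShallowMinor1 H G →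
               numEdges H < k * m

record Subgraph {n : ℕ} (G : Graph n) : Set where
  field
    S    : Subset n
    F    : Fin n → Fin n → Bool
    Fsym : ∀ u v → F u v ≡ F v u
    F⊆   : ∀ u v → F u v ≡ true → adj G u v ≡ true × u ∈ S × v ∈ S
open Subgraph public

IsIndependentIn : ∀ {n} {G : Graph n} → Subgraph G → Subset n → Set
IsIndependentIn H I = I ⊆ S H × (∀ u v → u ∈ I → v ∈ I → F H u v ≡ false)

IsIndependenceNumber : ∀ {n} {G : Graph n} → Subgraph G → ℕ → Set
IsIndependenceNumber {n} H k =
  (∃[ I ] (IsIndependentIn H I × ∣ I ∣ ≡ k)) ×
  (∀ (I : Subset n) → IsIndependentIn H I → ∣ I ∣ ≤ k)

-- x ≤ ρ(G) · γ, where ρ(G) = max over (non-empty) subgraphs H of |V(H)|/α(H):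
-- since the maximum is attained, this holds iff some non-empty subgraph H has
-- x · α(H) ≤ |V(H)| · γ.
≤HallRatio* : ∀ {n} → Graph n → ℕ → ℕ → Set
≤HallRatio* G x γ = ∃[ H ] ∃[ a ] (IsIndependenceNumber {G = G} H a × 1 ≤ ∣ S H ∣ × x * a ≤ ∣ S H ∣ * γ)

InDhat : ∀ {n} → Graph n → Subset n → ℕ → Fin n → Set
InDhat G D ∇ v = ∀ A → A ⊆ D → v ∉ A → NbhdCovered G v A → 2 * ∇ ∸ 1 < ∣ A ∣

InD1 : ∀ {n} → Graph n → ℕ → Fin n → Set
InD1 G ∇ v = ∀ A → v ∉ A → NbhdCovered G v A → 2 * ∇ ∸ 1 < ∣ A ∣

-- D₁ ⊆ D̂ because D̂ quantifies over fewer sets A. For the Hall-ratio bound it suffices that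
-- every independent set I ⊆ D₁ ∖ D has |I| ≤ |D|. Contract G onto a bipartite 1-shallow minor
-- H with one side I and the other side D, where d ∈ D carries the vertices outside I that it
-- dominates. The neighbours of u ∈ I in H form a subset of D that covers N(u) and avoids u, so
-- u ∈ D̂ gives u at least 2∇ neighbours, and H has at least 2∇|I| edges. If |I| > |D| this is
-- at least ∇(|I| + |D|) = ∇|V(H)|, contradicting ∇₁ᴮ(G) < ∇.

module Submission where

open import Data.Bool using (Bool; true; false; _∧_)
open import Data.Bool.Properties using (∧-comm) renaming (_≟_ to _≟ᵇ_)
open import Data.Empty using (⊥; ⊥-elim)
open import Data.Fin using (Fin; zero; suc; toℕ; _↑ˡ_; _↑ʳ_; splitAt; join)
open import Data.Fin.Properties
  using (_≟_; suc-injective; any?; all?; splitAt-↑ˡ; splitAt-↑ʳ; join-splitAt; toℕ-↑ˡ; toℕ-↑ʳ; toℕ<n)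
open import Data.Fin.Subset using (Subset; _∈_; _∉_; _⊆_; _─_; ∣_∣; ⁅_⁆; ⊤; inside; outside) renaming (⊥ to ∅)
open import Data.Fin.Subset.Properties
  using (_∈?_; _⊆?_; anySubset?; x∈⁅x⁆; x∈⁅y⁆⇒x≡y; drop-∷-⊆; ∣p∣≤n; ∣⊤∣≡n; ∣⊥∣≡0; ∉⊥; p─q⊆p)
open import Data.List using (List; _++_; length; filter; concatMap; map; tabulate; allFin)
open import Data.List.Properties using (filter-++; length-++; map-tabulate)
open import Data.Nat using (ℕ; zero; suc; _+_; _*_; _∸_; _≤_; _<_; z≤n; s≤s; _≤?_)
open import Data.Nat.Properties
  using ( +-0-monoid; +-mono-≤; +-monoʳ-≤; *-monoʳ-≤; ≤-refl; ≤-trans; ≤-pred; m≤m+n; m≤n+m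
        ; <⇒≤; ≤∧≢⇒<; ≮⇒≥; <-irrefl; n≤0⇒n≡0; _<?_; module ≤-Reasoning)
  renaming (_≟_ to _≟ℕ_)
open import Data.Nat.Tactic.RingSolver using (solve-∀)
open import Data.Product using (∃-syntax; _×_; _,_; proj₁; proj₂)
open import Data.Sum using (_⊎_; inj₁; inj₂; map₁)
open import Data.Vec using ([]; _∷_; lookup; here; there) renaming (tabulate to tabulateᵛ)
open import Data.Vec.Properties using (lookup∘tabulate; []=⇒lookup; lookup⇒[]=)
open import Function using (_∘_; id)
open import Function.Bundles using (_⇔_; Equivalence)
open import Relation.Binary.PropositionalEquality
  using (_≡_; refl; sym; trans; cong; cong₂; subst; module ≡-Reasoning)
open import Relation.Nullary using (Dec; yes; no; does; ¬?)
open import Relation.Nullary.Decidable using (_×-dec_; _→-dec_; dec-true)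
open import Relation.Unary using (Pred; Decidable)
open import Defs hiding (sym)

open import Algebra.Properties.Monoid.Sum +-0-monoid using (sum; sum-syntax; sum-cong-≗)

∑-mono-≤ : ∀ {k} {f g : Fin k → ℕ} → (∀ i → f i ≤ g i) → sum f ≤ sum g
∑-mono-≤ {zero}  f≤g = z≤n
∑-mono-≤ {suc k} f≤g = +-mono-≤ (f≤g zero) (∑-mono-≤ (f≤g ∘ suc))

*≤∑ : ∀ {k c} {f : Fin k → ℕ} → (∀ i → c ≤ f i) → k * c ≤ sum f
*≤∑ {zero}  c≤f = z≤n
*≤∑ {suc k} c≤f = +-mono-≤ (c≤f zero) (*≤∑ (c≤f ∘ suc))

∑-↑ˡ-≤ : ∀ k l (f : Fin (k + l) → ℕ) → ∑[ i < k ] f (i ↑ˡ l) ≤ sum f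
∑-↑ˡ-≤ zero    l f = z≤n
∑-↑ˡ-≤ (suc k) l f = +-monoʳ-≤ (f zero) (∑-↑ˡ-≤ k l (f ∘ suc))

∑-↑ʳ-≤ : ∀ k l (f : Fin (k + l) → ℕ) → ∑[ i < l ] f (k ↑ʳ i) ≤ sum f
∑-↑ʳ-≤ zero    l f = ≤-refl
∑-↑ʳ-≤ (suc k) l f = ≤-trans (∑-↑ʳ-≤ k l (f ∘ suc)) (m≤n+m _ (f zero))

𝟙 : Bool → ℕ
𝟙 true  = 1
𝟙 false = 0

module _ {a p} {A : Set a} {P : Pred A p} (P? : Decidable P) where

  length-filter-tabulate : ∀ {k} (f : Fin k → A) →
                           length (filter P? (tabulate f)) ≡ ∑[ i < k ] 𝟙 (does (P? (f i)))
  length-filter-tabulate {zero}  f = refl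
  length-filter-tabulate {suc k} f with does (P? (f zero))
  ... | true  = cong suc (length-filter-tabulate (f ∘ suc))
  ... | false = length-filter-tabulate (f ∘ suc)

  length-filter-concatMap-tabulate :
    ∀ {b} {B : Set b} {k} (g : B → List A) (f : Fin k → B) →
    length (filter P? (concatMap g (tabulate f))) ≡ ∑[ i < k ] length (filter P? (g (f i)))
  length-filter-concatMap-tabulate {k = zero}  g f = refl
  length-filter-concatMap-tabulate {k = suc k} g f = begin
    length (filter P? (g (f zero) ++ rest))
      ≡⟨ cong length (filter-++ P? (g (f zero)) rest) ⟩
    length (filter P? (g (f zero)) ++ filter P? rest)
      ≡⟨ length-++ (filter P? (g (f zero))) ⟩
    length (filter P? (g (f zero))) + length (filter P? rest)
      ≡⟨ cong (length (filter P? (g (f zero))) +_) (length-filter-concatMap-tabulate g (f ∘ suc)) ⟩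
    ∑[ i < suc k ] length (filter P? (g (f i))) ∎
    where
    open ≡-Reasoning
    rest = concatMap g (tabulate (f ∘ suc))

length-filter-allPairs : ∀ {m p} {P : Pred (Fin m × Fin m) p} (P? : Decidable P) →
                         length (filter P? (allPairs m)) ≡ ∑[ u < m ] ∑[ v < m ] 𝟙 (does (P? (u , v)))
length-filter-allPairs {m} P? = begin
  length (filter P? (allPairs m))
    ≡⟨ length-filter-concatMap-tabulate P? (λ u → map (u ,_) (allFin m)) id ⟩
  ∑[ u < m ] length (filter P? (map (u ,_) (allFin m)))
    ≡⟨ sum-cong-≗ (λ u → cong (length ∘ filter P?) (map-tabulate id (u ,_))) ⟩
  ∑[ u < m ] length (filter P? (tabulate (u ,_)))
    ≡⟨ sum-cong-≗ (λ u → length-filter-tabulate P? (u ,_)) ⟩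
  ∑[ u < m ] ∑[ v < m ] 𝟙 (does (P? (u , v))) ∎
  where open ≡-Reasoning

𝟙-≟true : ∀ b → 𝟙 (does (b ≟ᵇ true)) ≡ 𝟙 b
𝟙-≟true true  = refl
𝟙-≟true false = refl

crossEdges≤numEdges : ∀ k l (H : Graph (k + l)) →
                      ∑[ a < k ] ∑[ b < l ] 𝟙 (adj H (a ↑ˡ l) (k ↑ʳ b)) ≤ numEdges H
crossEdges≤numEdges k l H = begin
  ∑[ a < k ] ∑[ b < l ] 𝟙 (adj H (a ↑ˡ l) (k ↑ʳ b))
    ≡⟨ sum-cong-≗ (λ a → sum-cong-≗ (λ b → sym (counted a b))) ⟩
  ∑[ a < k ] ∑[ b < l ] edge (a ↑ˡ l) (k ↑ʳ b)
    ≤⟨ ∑-mono-≤ (λ a → ∑-↑ʳ-≤ k l (edge (a ↑ˡ l))) ⟩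
  ∑[ a < k ] ∑[ v < k + l ] edge (a ↑ˡ l) v
    ≤⟨ ∑-↑ˡ-≤ k l (λ u → ∑[ v < k + l ] edge u v) ⟩
  ∑[ u < k + l ] ∑[ v < k + l ] edge u v
    ≡⟨ sym (length-filter-allPairs ordered-edge?) ⟩
  numEdges H ∎
  where
  open ≤-Reasoning
  ordered-edge? : Decidable λ (p : Fin (k + l) × Fin (k + l)) →
                  toℕ (proj₁ p) < toℕ (proj₂ p) × adj H (proj₁ p) (proj₂ p) ≡ true
  ordered-edge? (u , v) = (toℕ u <? toℕ v) ×-dec (adj H u v ≟ᵇ true)
  edge : Fin (k + l) → Fin (k + l) → ℕ
  edge u v = 𝟙 (does (ordered-edge? (u , v)))
  left<right : ∀ a b → toℕ (a ↑ˡ l) < toℕ (k ↑ʳ b)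
  left<right a b rewrite toℕ-↑ˡ a l | toℕ-↑ʳ k b = ≤-trans (toℕ<n a) (m≤m+n k (toℕ b))
  counted : ∀ a b → edge (a ↑ˡ l) (k ↑ʳ b) ≡ 𝟙 (adj H (a ↑ˡ l) (k ↑ʳ b))
  counted a b rewrite dec-true (toℕ (a ↑ˡ l) <? toℕ (k ↑ʳ b)) (left<right a b) =
    𝟙-≟true (adj H (a ↑ˡ l) (k ↑ʳ b))

enum : ∀ {n} (p : Subset n) → Fin ∣ p ∣ → Fin n
enum (inside  ∷ p) zero    = zero
enum (inside  ∷ p) (suc i) = suc (enum p i)
enum (outside ∷ p) i       = suc (enum p i)

enum-∈ : ∀ {n} (p : Subset n) i → enum p i ∈ p
enum-∈ (inside  ∷ p) zero    = here
enum-∈ (inside  ∷ p) (suc i) = there (enum-∈ p i)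
enum-∈ (outside ∷ p) i       = there (enum-∈ p i)

enum-injective : ∀ {n} (p : Subset n) {i j} → enum p i ≡ enum p j → i ≡ j
enum-injective (inside  ∷ p) {zero}  {zero}  _  = refl
enum-injective (inside  ∷ p) {suc i} {suc j} eq = cong suc (enum-injective p (suc-injective eq))
enum-injective (inside  ∷ p) {zero}  {suc j} ()
enum-injective (inside  ∷ p) {suc i} {zero}  ()
enum-injective (outside ∷ p)                 eq = enum-injective p (suc-injective eq)

∣q∣≡∑-enum : ∀ {n} {p q : Subset n} → q ⊆ p → ∣ q ∣ ≡ ∑[ i < ∣ p ∣ ] 𝟙 (lookup q (enum p i))
∣q∣≡∑-enum {p = []}          {[]}          q⊆p = refl
∣q∣≡∑-enum {p = inside  ∷ p} {inside  ∷ q} q⊆p = cong suc (∣q∣≡∑-enum (drop-∷-⊆ q⊆p))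
∣q∣≡∑-enum {p = inside  ∷ p} {outside ∷ q} q⊆p = ∣q∣≡∑-enum (drop-∷-⊆ q⊆p)
∣q∣≡∑-enum {p = outside ∷ p} {outside ∷ q} q⊆p = ∣q∣≡∑-enum (drop-∷-⊆ q⊆p)
∣q∣≡∑-enum {p = outside ∷ p} {inside  ∷ q} q⊆p with () ← q⊆p here

x∈p─q⇒x∉q : ∀ {n} (p q : Subset n) {x} → x ∈ p ─ q → x ∉ q
x∈p─q⇒x∉q (inside ∷ p) (outside ∷ q) here          ()
x∈p─q⇒x∉q (_      ∷ p) (_       ∷ q) (there x∈p─q) (there x∈q) = x∈p─q⇒x∉q p q x∈p─q x∈q

does≡true⇒ : ∀ {p} {P : Set p} (P? : Dec P) → does P? ≡ true → P
does≡true⇒ (yes p) _ = p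

module _ {n p} {P : Pred (Fin n) p} (P? : Decidable P) where

  toSubset : Subset n
  toSubset = tabulateᵛ (does ∘ P?)

  ∈toSubset⁺ : ∀ {x} → P x → x ∈ toSubset
  ∈toSubset⁺ {x} px = lookup⇒[]= x toSubset (trans (lookup∘tabulate (does ∘ P?) x) (dec-true (P? x) px))

  ∈toSubset⁻ : ∀ {x} → x ∈ toSubset → P x
  ∈toSubset⁻ {x} x∈ = does≡true⇒ (P? x) (trans (sym (lookup∘tabulate (does ∘ P?) x)) ([]=⇒lookup x∈))

greatest-≤ : ∀ {q} {Q : Pred ℕ q} → Decidable Q → Q 0 → ∀ B → (∀ k → Q k → k ≤ B) →
             ∃[ k ] (Q k × (∀ j → Q j → j ≤ k))
greatest-≤ Q? q0 zero    Q≤B = 0 , q0 , Q≤B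
greatest-≤ {Q = Q} Q? q0 (suc B) Q≤B with Q? (suc B)
... | yes qB = suc B , qB , Q≤B
... | no ¬qB = greatest-≤ Q? q0 B Q≤B′
  where
  Q≤B′ : ∀ k → Q k → k ≤ B
  Q≤B′ k qk = ≤-pred (≤∧≢⇒< (Q≤B k qk) λ { refl → ¬qB qk })

IsIndependent : ∀ {n} → Graph n → Subset n → Set
IsIndependent G I = ∀ u v → u ∈ I → v ∈ I → adj G u v ≡ false

module _ {n} {G : Graph n} (H : Subgraph G) where

  isIndependentIn? : Decidable (IsIndependentIn H)
  isIndependentIn? I = (I ⊆? S H) ×-dec
    all? (λ u → all? (λ v → (u ∈? I) →-dec (v ∈? I) →-dec (F H u v ≟ᵇ false)))

  independenceNumber : ∃[ a ] IsIndependenceNumber H a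
  independenceNumber with greatest-≤ size? size∅ n size≤n
    where
    size? : Decidable λ k → ∃[ I ] (IsIndependentIn H I × ∣ I ∣ ≡ k)
    size? k = anySubset? (λ I → isIndependentIn? I ×-dec (∣ I ∣ ≟ℕ k))
    size∅ : ∃[ I ] (IsIndependentIn H I × ∣ I ∣ ≡ 0)
    size∅ = ∅ , ((λ x∈∅ → ⊥-elim (∉⊥ x∈∅)) , (λ u v u∈∅ → ⊥-elim (∉⊥ u∈∅))) , ∣⊥∣≡0 n
    size≤n : ∀ k → ∃[ I ] (IsIndependentIn H I × ∣ I ∣ ≡ k) → k ≤ n
    size≤n k (I , _ , refl) = ∣p∣≤n I
  ... | a , sized , maximal = a , sized , λ I I-indep → maximal ∣ I ∣ (I , I-indep , refl)

induced : ∀ {n} (G : Graph n) → Subset n → Subgraph G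
induced {n} G X = record { S = X ; F = F′ ; Fsym = F′-sym ; F⊆ = λ u v → does≡true⇒ (edge? u v) }
  where
  edge? : ∀ u v → Dec (adj G u v ≡ true × u ∈ X × v ∈ X)
  edge? u v = (adj G u v ≟ᵇ true) ×-dec (u ∈? X) ×-dec (v ∈? X)
  F′ : Fin n → Fin n → Bool
  F′ u v = does (edge? u v)
  F′-sym : ∀ u v → F′ u v ≡ F′ v u
  F′-sym u v = cong₂ _∧_ (cong (does ∘ (_≟ᵇ true)) (Graph.sym G u v)) (∧-comm (does (u ∈? X)) (does (v ∈? X)))

induced-independent : ∀ {n} (G : Graph n) X {I} → IsIndependentIn (induced G X) I → IsIndependent G I
induced-independent G X (I⊆X , F≡false) u v u∈I v∈I with adj G u v in uv
... | false = refl
... | true with () ← trans (sym (dec-true ((adj G u v ≟ᵇ true) ×-dec (u ∈? X) ×-dec (v ∈? X))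
                                          (uv , I⊆X u∈I , I⊆X v∈I)))
                           (F≡false u v u∈I v∈I)

α≤⇒≤HallRatio* : ∀ {n} (G : Graph (suc n)) (X : Subset (suc n)) γ →
                 (∀ I → I ⊆ X → IsIndependent G I → ∣ I ∣ ≤ γ) → ≤HallRatio* G ∣ X ∣ γ
α≤⇒≤HallRatio* {n} G X γ α≤γ with 1 ≤? ∣ X ∣
... | yes X-nonempty
  with a , α@((I , I-indep , refl) , _) ← independenceNumber (induced G X)
  = induced G X , a , α , X-nonempty ,
    *-monoʳ-≤ ∣ X ∣ (α≤γ I (proj₁ I-indep) (induced-independent G X I-indep))
-- For empty X any non-empty subgraph witnesses the bound; this is where G needs a vertex.
... | no X-empty rewrite n≤0⇒n≡0 (≮⇒≥ X-empty)
  with a , α ← independenceNumber (induced G ⊤)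
  = induced G ⊤ , a , α , subst (1 ≤_) (sym (∣⊤∣≡n (suc n))) (s≤s z≤n) , z≤n

-- The bipartite minor

module DominatorMinor {n} (G : Graph n) (D : Subset n) (D-dominating : IsDominating G D)
                      (I : Subset n) (I-independent : IsIndependent G I)
                      (I∩D≡∅ : ∀ {u} → u ∈ I → u ∉ D) where

  -- Checking w ∈ D first makes every d ∈ D its own dominator, hence the centre of its territory.
  dominatorOf : ∀ w → ∃[ d ] (d ∈ D × (d ≡ w ⊎ adj G d w ≡ true) × (w ∈ D → d ≡ w))
  dominatorOf w with w ∈? D | D-dominating w
  ... | yes w∈D | _                    = w , w∈D , inj₁ refl , λ _ → refl
  ... | no  w∉D | inj₁ w∈D             = ⊥-elim (w∉D w∈D)
  ... | no  w∉D | inj₂ (d , d∈D , d~w) = d , d∈D , inj₂ d~w , λ w∈D → ⊥-elim (w∉D w∈D)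

  dominator : Fin n → Fin n
  dominator w = proj₁ (dominatorOf w)

  dominator∈D : ∀ w → dominator w ∈ D
  dominator∈D w = proj₁ (proj₂ (dominatorOf w))

  dominator-near : ∀ w → dominator w ≡ w ⊎ adj G (dominator w) w ≡ true
  dominator-near w = proj₁ (proj₂ (proj₂ (dominatorOf w)))

  dominator-fixes-D : ∀ {w} → w ∈ D → dominator w ≡ w
  dominator-fixes-D {w} = proj₂ (proj₂ (proj₂ (dominatorOf w)))

  InTerritory : Fin n → Fin n → Set
  InTerritory d w = w ∉ I × dominator w ≡ d

  inTerritory? : ∀ d → Decidable (InTerritory d)
  inTerritory? d w = ¬? (w ∈? I) ×-dec (dominator w ≟ d)

  territory : Fin n → Subset n
  territory d = toSubset (inTerritory? d)

  territory⁺ : ∀ {d w} → InTerritory d w → w ∈ territory d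
  territory⁺ {d} = ∈toSubset⁺ (inTerritory? d)

  territory⁻ : ∀ {d w} → w ∈ territory d → InTerritory d w
  territory⁻ {d} = ∈toSubset⁻ (inTerritory? d)

  Touches : Fin n → Fin n → Set
  Touches u d = ∃[ w ] (adj G u w ≡ true × w ∈ territory d)

  touches? : ∀ u d → Dec (Touches u d)
  touches? u d = any? (λ w → (adj G u w ≟ᵇ true) ×-dec (w ∈? territory d))

  touched : Fin n → Subset n
  touched u = toSubset (touches? u)

  touched⊆D : ∀ {u} → touched u ⊆ D
  touched⊆D {u} d∈touched with w , _ , w∈territory ← ∈toSubset⁻ (touches? u) d∈touched =
    subst (_∈ D) (proj₂ (territory⁻ w∈territory)) (dominator∈D w)

  touched-covers : ∀ {u} → u ∈ I → NbhdCovered G u (touched u)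
  touched-covers {u} u∈I w u~w = cover (dominator-near w)
    where
    w∉I : w ∉ I
    w∉I w∈I with () ← trans (sym u~w) (I-independent u w u∈I w∈I)
    d∈touched : dominator w ∈ touched u
    d∈touched = ∈toSubset⁺ (touches? u) (w , u~w , territory⁺ (w∉I , refl))
    cover : dominator w ≡ w ⊎ adj G (dominator w) w ≡ true → InNSet G (touched u) w
    cover (inj₁ d≡w) = inj₁ (subst (_∈ touched u) d≡w d∈touched)
    cover (inj₂ d~w) = inj₂ (dominator w , d∈touched , d~w)

  Index : Set
  Index = Fin ∣ I ∣ ⊎ Fin ∣ D ∣

  adjᴵ : Index → Index → Bool
  adjᴵ (inj₁ a) (inj₂ b) = does (touches? (enum I a) (enum D b))
  adjᴵ (inj₂ b) (inj₁ a) = does (touches? (enum I a) (enum D b))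
  adjᴵ (inj₁ _) (inj₁ _) = false
  adjᴵ (inj₂ _) (inj₂ _) = false

  adjᴵ-sym : ∀ x y → adjᴵ x y ≡ adjᴵ y x
  adjᴵ-sym (inj₁ _) (inj₁ _) = refl
  adjᴵ-sym (inj₁ _) (inj₂ _) = refl
  adjᴵ-sym (inj₂ _) (inj₁ _) = refl
  adjᴵ-sym (inj₂ _) (inj₂ _) = refl

  adjᴵ-irrefl : ∀ x → adjᴵ x x ≡ false
  adjᴵ-irrefl (inj₁ _) = refl
  adjᴵ-irrefl (inj₂ _) = refl

  index : Fin (∣ I ∣ + ∣ D ∣) → Index
  index = splitAt ∣ I ∣

  index-injective : ∀ {i j} → index i ≡ index j → i ≡ j
  index-injective {i} {j} eq =
    trans (sym (join-splitAt ∣ I ∣ ∣ D ∣ i)) (trans (cong (join ∣ I ∣ ∣ D ∣) eq) (join-splitAt ∣ I ∣ ∣ D ∣ j))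

  H : Graph (∣ I ∣ + ∣ D ∣)
  H = record
    { adj    = λ i j → adjᴵ (index i) (index j)
    ; sym    = λ i j → adjᴵ-sym (index i) (index j)
    ; irrefl = λ i → adjᴵ-irrefl (index i)
    }

  H-bipartite : IsBipartite H
  H-bipartite = side ∘ index , λ i j → separated (index i) (index j)
    where
    side : Index → Bool
    side (inj₁ _) = true
    side (inj₂ _) = false
    separated : ∀ x y → adjᴵ x y ≡ true → side x ≡ side y → ⊥
    separated (inj₁ _) (inj₂ _) _ ()
    separated (inj₂ _) (inj₁ _) _ ()

  branch : Index → Subset n
  branch (inj₁ a) = ⁅ enum I a ⁆
  branch (inj₂ b) = territory (enum D b)

  centre : Index → Fin n
  centre (inj₁ a) = enum I a
  centre (inj₂ b) = enum D b

  centre∈branch : ∀ x → centre x ∈ branch x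
  centre∈branch (inj₁ a) = x∈⁅x⁆ (enum I a)
  centre∈branch (inj₂ b) = territory⁺ ((λ d∈I → I∩D≡∅ d∈I d∈D) , dominator-fixes-D d∈D)
    where d∈D = enum-∈ D b

  branch-star : ∀ x v → v ∈ branch x → v ≡ centre x ⊎ adj G (centre x) v ≡ true
  branch-star (inj₁ a) v v∈ = inj₁ (x∈⁅y⁆⇒x≡y (enum I a) v∈)
  branch-star (inj₂ b) v v∈ =
    subst (λ d → v ≡ d ⊎ adj G d v ≡ true) (proj₂ (territory⁻ v∈)) (map₁ sym (dominator-near v))

  branch-disjoint : ∀ x y v → v ∈ branch x → v ∈ branch y → x ≡ y
  branch-disjoint (inj₁ a) (inj₁ a′) v v∈ v∈′ =
    cong inj₁ (enum-injective I (trans (sym (x∈⁅y⁆⇒x≡y _ v∈)) (x∈⁅y⁆⇒x≡y _ v∈′)))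
  branch-disjoint (inj₁ a) (inj₂ b) v v∈ v∈′ =
    ⊥-elim (proj₁ (territory⁻ v∈′) (subst (_∈ I) (sym (x∈⁅y⁆⇒x≡y _ v∈)) (enum-∈ I a)))
  branch-disjoint (inj₂ b) (inj₁ a) v v∈ v∈′ =
    ⊥-elim (proj₁ (territory⁻ v∈) (subst (_∈ I) (sym (x∈⁅y⁆⇒x≡y _ v∈′)) (enum-∈ I a)))
  branch-disjoint (inj₂ b) (inj₂ b′) v v∈ v∈′ =
    cong inj₂ (enum-injective D (trans (sym (proj₂ (territory⁻ v∈))) (proj₂ (territory⁻ v∈′))))

  branch-realise : ∀ x y → adjᴵ x y ≡ true →
                   ∃[ u ] ∃[ v ] (u ∈ branch x × v ∈ branch y × adj G u v ≡ true)
  branch-realise (inj₁ a) (inj₂ b) xy with w , u~w , w∈ ← does≡true⇒ (touches? _ _) xy =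
    enum I a , w , x∈⁅x⁆ (enum I a) , w∈ , u~w
  branch-realise (inj₂ b) (inj₁ a) xy with w , u~w , w∈ ← does≡true⇒ (touches? _ _) xy =
    w , enum I a , w∈ , x∈⁅x⁆ (enum I a) , trans (Graph.sym G w (enum I a)) u~w

  H-minor : ShallowMinor1 H G
  H-minor = record
    { branch   = branch ∘ index
    ; centre   = centre ∘ index
    ; centre∈  = centre∈branch ∘ index
    ; star     = branch-star ∘ index
    ; disjoint = λ i j v v∈ v∈′ → index-injective (branch-disjoint (index i) (index j) v v∈ v∈′)
    ; realise  = λ i j → branch-realise (index i) (index j)
    }

  ∣touched∣≡degree : ∀ a → ∣ touched (enum I a) ∣ ≡ ∑[ b < ∣ D ∣ ] 𝟙 (adj H (a ↑ˡ ∣ D ∣) (∣ I ∣ ↑ʳ b))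
  ∣touched∣≡degree a = trans (∣q∣≡∑-enum touched⊆D) (sum-cong-≗ λ b → cong 𝟙 (begin
    lookup (touched (enum I a)) (enum D b)
      ≡⟨ lookup∘tabulate _ (enum D b) ⟩
    adjᴵ (inj₁ a) (inj₂ b)
      ≡⟨ sym (cong₂ adjᴵ (splitAt-↑ˡ (∣ I ∣) a (∣ D ∣)) (splitAt-↑ʳ (∣ I ∣) (∣ D ∣) b)) ⟩
    adj H (a ↑ˡ ∣ D ∣) (∣ I ∣ ↑ʳ b) ∎))
    where open ≡-Reasoning

∸1<⇒≤ : ∀ m {n} → m ∸ 1 < n → m ≤ n
∸1<⇒≤ zero    _ = z≤n
∸1<⇒≤ (suc m) m<n = m<n

independent⊆D̂─D⇒∣I∣≤∣D∣ :
  ∀ {n} {G : Graph n} {D I : Subset n} {∇} → IsDominating G D → Nabla1B< G ∇ →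
  IsIndependent G I → (∀ {u} → u ∈ I → u ∉ D) → (∀ u → u ∈ I → InDhat G D ∇ u) → ∣ I ∣ ≤ ∣ D ∣
independent⊆D̂─D⇒∣I∣≤∣D∣ {G = G} {D} {I} {∇} D-dominating ∇ᴮ<∇ I-independent I∩D≡∅ I⊆D̂ =
  ≮⇒≥ λ ∣D∣<∣I∣ → <-irrefl refl (begin-strict
    ∇ * (∣ I ∣ + ∣ D ∣)
      ≤⟨ balanced (<⇒≤ ∣D∣<∣I∣) ⟩
    ∣ I ∣ * (2 * ∇)
      ≤⟨ *≤∑ degree ⟩
    ∑[ a < ∣ I ∣ ] ∑[ b < ∣ D ∣ ] 𝟙 (adj H (a ↑ˡ ∣ D ∣) (∣ I ∣ ↑ʳ b))
      ≤⟨ crossEdges≤numEdges ∣ I ∣ ∣ D ∣ H ⟩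
    numEdges H
      <⟨ ∇ᴮ<∇ _ H (≤-trans (≤-trans (s≤s z≤n) ∣D∣<∣I∣) (m≤m+n ∣ I ∣ ∣ D ∣)) H-bipartite H-minor ⟩
    ∇ * (∣ I ∣ + ∣ D ∣) ∎)
  where
  open DominatorMinor G D D-dominating I I-independent I∩D≡∅
  open ≤-Reasoning
  balanced : ∣ D ∣ ≤ ∣ I ∣ → ∇ * (∣ I ∣ + ∣ D ∣) ≤ ∣ I ∣ * (2 * ∇)
  balanced ∣D∣≤∣I∣ = begin
    ∇ * (∣ I ∣ + ∣ D ∣) ≤⟨ *-monoʳ-≤ ∇ (+-monoʳ-≤ ∣ I ∣ ∣D∣≤∣I∣) ⟩
    ∇ * (∣ I ∣ + ∣ I ∣) ≡⟨ doubling ∣ I ∣ ∇ ⟩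
    ∣ I ∣ * (2 * ∇)     ∎
    where
    doubling : ∀ i k → k * (i + i) ≡ i * (2 * k)
    doubling = solve-∀
  degree : ∀ a → 2 * ∇ ≤ ∑[ b < ∣ D ∣ ] 𝟙 (adj H (a ↑ˡ ∣ D ∣) (∣ I ∣ ↑ʳ b))
  degree a = subst (2 * ∇ ≤_) (∣touched∣≡degree a)
    (∸1<⇒≤ (2 * ∇) (I⊆D̂ u u∈I (touched u) touched⊆D (λ u∈ → I∩D≡∅ u∈I (touched⊆D u∈)) (touched-covers u∈I)))
    where
    u   = enum I a
    u∈I = enum-∈ I a

lemma4p2 : ∀ (n : ℕ) (G : Graph (suc n)) (D : Subset (suc n)) → IsMinDominating G D →
           ∀ (∇₁ ∇ : ℕ) → Nabla1≤ G ∇₁ → Nabla1B< G ∇ → ∇ ≤ suc ∇₁ →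
           ∀ (D₁ : Subset (suc n)) → (∀ v → (v ∈ D₁) ⇔ InD1 G ∇ v) →
           (∀ v → InD1 G ∇ v → InDhat G D ∇ v) × ≤HallRatio* G ∣ D₁ ─ D ∣ ∣ D ∣
lemma4p2 n G D (D-dominating , _) _ ∇ _ ∇ᴮ<∇ _ D₁ D₁-spec = D₁⊆D̂ , α≤⇒≤HallRatio* G (D₁ ─ D) ∣ D ∣ α≤∣D∣
  where
  D₁⊆D̂ : ∀ v → InD1 G ∇ v → InDhat G D ∇ v
  D₁⊆D̂ v v∈D₁ A _ = v∈D₁ A
  α≤∣D∣ : ∀ I → I ⊆ D₁ ─ D → IsIndependent G I → ∣ I ∣ ≤ ∣ D ∣
  α≤∣D∣ I I⊆D₁─D I-independent = independent⊆D̂─D⇒∣I∣≤∣D∣ {∇ = ∇} D-dominating ∇ᴮ<∇ I-independent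
    (λ u∈I → x∈p─q⇒x∉q D₁ D (I⊆D₁─D u∈I))
    (λ u u∈I → D₁⊆D̂ u (Equivalence.to (D₁-spec u) (p─q⊆p D₁ D (I⊆D₁─D u∈I))))
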